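{- Every $2$-degenerate graph $G$ is equitable list point $k$-arborable for every integer $k\geq \lceil (\Delta(G)+1)/2\rceil$, where $\Delta(G)$ is the maximum degree of $G$.
   Context: All graphs are finite, simple and undirected. A graph is $d$-degenerate if every subgraph of it has a vertex of degree at most $d$. A $k$-list assignment of a graph $G$ assigns to each vertex $v$ a set (list) $L(v)$ of $k$ colors. A graph $G$ is equitable list point $k$-arborable if for every $k$-list assignment $L$ one can choose $c(v)\in L(v)$ for each vertex $v$ such that each color class induces an acyclic subgraph (a forest) of $G$ and each color appears on at most $\lceil |V(G)|/k\rceil$ vertices of $G$. -}

module Defs where

open import Data.Nat using (ℕ; zero; suc; _+_; _*_; _≤_; _⊔_)
open import Data.Nat.DivMod using (_/_)
open import Data.Nat.Base using (⌈_/2⌉)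
open import Data.Nat.Properties using (_≟_)
open import Data.Bool using (Bool; true; false; if_then_else_)
open import Data.Fin using (Fin; zero; suc)
open import Data.Fin.Patterns using (0F)
open import Data.List using (List; length; foldr; allFin)
open import Data.List.Membership.Propositional using (_∈_)
open import Data.List.Relation.Unary.Unique.Propositional using (Unique)
open import Data.Product using (Σ; _×_; ∃; ∃-syntax)
open import Function.Definitions using (Injective)
open import Relation.Binary.PropositionalEquality using (_≡_)
open import Relation.Nullary using (¬_)
open import Relation.Nullary.Decidable using (⌊_⌋)

record Graph : Set where
  field
    n     : ℕ
    adj   : Fin n → Fin n → Bool
    sym   : ∀ u v → adj u v ≡ adj v u
    irrefl : ∀ v → adj v v ≡ false
open Graph public

countF : {m : ℕ} → (Fin m → Bool) → ℕ
countF {m} P = foldr (λ x acc → if P x then suc acc else acc) 0 (allFin m)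

degree : (G : Graph) → Fin (n G) → ℕ
degree G v = countF (adj G v)

maxDegree : Graph → ℕ
maxDegree G = foldr (λ v acc → degree G v ⊔ acc) 0 (allFin (n G))

-- ⌈ m / k ⌉ (with the irrelevant convention ⌈ m / 0 ⌉ = 0)
ceilDiv : ℕ → ℕ → ℕ
ceilDiv m zero    = 0
ceilDiv m (suc k) = (m + k) / suc k

record Subgraph (G : Graph) : Set where
  field
    S       : Fin (n G) → Bool
    H       : Fin (n G) → Fin (n G) → Bool
    H-sym   : ∀ u v → H u v ≡ H v u
    H⊆E     : ∀ u v → H u v ≡ true → adj G u v ≡ true
    H-inS   : ∀ u v → H u v ≡ true → S u ≡ true
open Subgraph public

Degenerate : ℕ → Graph → Set
Degenerate d G =
  (K : Subgraph G) → ∃[ v ] S K v ≡ true →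
  ∃[ v ] (S K v ≡ true × countF (H K v) ≤ d)

record Cycle (G : Graph) : Set where
  field
    len     : ℕ
    vtx     : Fin (suc (suc (suc len))) → Fin (n G)
    inj     : Injective _≡_ _≡_ vtx
    step    : ∀ i → adj G (vtx (Data.Fin.inject₁ i)) (vtx (suc i)) ≡ true
    close   : adj G (vtx (Data.Fin.fromℕ (suc (suc len)))) (vtx 0F) ≡ true
open Cycle public

InducesForest : (G : Graph) → (Fin (n G) → Bool) → Set
InducesForest G P = (C : Cycle G) → ¬ (∀ i → P (vtx C i) ≡ true)

ListAssignment : Graph → ℕ → Set
ListAssignment G k =
  Σ (Fin (n G) → List ℕ) λ L → ∀ v → length (L v) ≡ k × Unique (L v)

colourClass : (G : Graph) → (Fin (n G) → ℕ) → ℕ → Fin (n G) → Bool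
colourClass G c a v = ⌊ c v ≟ a ⌋

EquitableListPointArborable : ℕ → Graph → Set
EquitableListPointArborable k G =
  (LA : ListAssignment G k) →
  Σ (Fin (n G) → ℕ) λ c →
    (∀ v → c v ∈ Data.Product.proj₁ LA v) ×
    (∀ a → InducesForest G (colourClass G c a)) ×
    (∀ a → countF (colourClass G c a) ≤ ceilDiv (n G) k)

module Submission where

-- The vertices are coloured in blocks of k (the last block may be smaller), the vertices of
-- a block getting pairwise distinct colours; so each colour is used at most once per block,
-- hence at most ⌈n/k⌉ times. A block is taken from the set T of uncoloured vertices, the rest
-- of T is coloured first, and then the block is coloured vertex by vertex: v gets a colour
-- of L v that is new in its block and carried by at most one already coloured neighbour, so
-- v closes no monochromatic cycle. If v is the (j+1)-st vertex of its block and has a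
-- coloured neighbours outside it, charging 2 to the colour of each earlier block vertex and
-- 1 to the colour of each such neighbour leaves a colour of charge ≤ 1 as soon as
-- a + 2j < 2k = 2|L v|. By 2-degeneracy a block can be ordered to meet this bound: first any
-- vertex u (a ≤ Δ ≤ 2k − 1), then vertices peeled off greedily, each with at most two
-- neighbours in the rest, and last a vertex x of degree ≤ 2 in T having u as a neighbour
-- if it has any (a ≤ 1).

open import Defs hiding (sym)
open import Data.Bool using (Bool; true; false; _∧_; _∨_; not; if_then_else_)
open import Data.Bool.Properties using (∨-zeroʳ; ∧-zeroʳ; ∨-assoc; not-¬; ¬-not)
open import Data.Empty using (⊥; ⊥-elim)
open import Data.Fin as Fin using (Fin; zero; suc; inject₁)
import Data.Fin.Properties as Finₚ
import Data.Fin.Relation.Unary.Top as Top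
open import Data.List using (List; []; _∷_; _++_; length; foldr; tabulate; allFin)
open import Data.List.Properties using (length-++)
open import Data.List.Membership.Propositional using (_∈_; _∉_)
open import Data.List.Membership.Propositional.Properties using (∈-++⁺ˡ; ∈-++⁺ʳ; ∈-++⁻; ∈-allFin)
open import Data.List.Relation.Unary.Any using (here; there)
import Data.List.Relation.Unary.All as All
open All using (All; []; _∷_)
import Data.List.Relation.Unary.All.Properties as Allₚ
open import Data.List.Relation.Unary.AllPairs using ([]; _∷_)
open import Data.List.Relation.Unary.Unique.Propositional using (Unique)
import Data.List.Relation.Unary.Unique.Propositional.Properties as Uniqueₚ
open import Data.Nat
  using (ℕ; zero; suc; _+_; _*_; _⊓_; _⊔_; ⌊_/2⌋; ⌈_/2⌉; _≤_; _<_; z≤n; s≤s; NonZero; >-nonZero⁻¹)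
open import Data.Nat.DivMod using (_/_; m<n⇒m/n≡0; m≥n⇒m/n>0; n/n≡1; +-distrib-/-∣ʳ)
open import Data.Nat.Divisibility using (∣-refl)
open import Data.Nat.Induction using (<-rec)
open import Data.Nat.Properties
open import Data.Nat.Tactic.RingSolver using (solve-∀)
open import Data.Product using (Σ; _×_; _,_; proj₁; proj₂; ∃-syntax)
open import Data.Sum using (_⊎_; inj₁; inj₂; [_,_]′; map₂)
open import Data.Unit using (⊤; tt)
open import Data.Vec.Functional using (updateAt)
open import Data.Vec.Functional.Properties using (updateAt-updates; updateAt-minimal)
open import Function using (_∘_; id; const)
open import Relation.Binary.PropositionalEquality
open import Relation.Nullary using (¬_; Dec; yes; no; contradiction)
open import Relation.Nullary.Decidable using (⌊_⌋)

private variable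
  m : ℕ
  i v : Fin m

Subset : ℕ → Set
Subset m = Fin m → Bool

infix 4 _∈ₛ_ _∉ₛ_ _⊆_ _≐_
infixr 7 _∩_
infixr 6 _∪_
infixl 5 _∖_

_∈ₛ_ _∉ₛ_ : Fin m → Subset m → Set
i ∈ₛ P = P i ≡ true
i ∉ₛ P = P i ≡ false

_⊆_ _≐_ : Subset m → Subset m → Set
P ⊆ Q = ∀ i → i ∈ₛ P → i ∈ₛ Q
P ≐ Q = ∀ i → P i ≡ Q i

AtMostOne : Subset m → Set
AtMostOne P = ∀ i j → i ∈ₛ P → j ∈ₛ P → i ≡ j

private variable
  P Q : Subset m
  B B′ b j : ℕ

private
  ∧≡true⁻ : ∀ {a b} → a ∧ b ≡ true → a ≡ true × b ≡ true
  ∧≡true⁻ {true} {true} _ = refl , refl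

  ∧≡true⁺ : ∀ {a b} → a ≡ true → b ≡ true → a ∧ b ≡ true
  ∧≡true⁺ refl refl = refl

  ∨≡true⁺ˡ : ∀ {a b} → a ≡ true → a ∨ b ≡ true
  ∨≡true⁺ˡ refl = refl

  ∨≡true⁺ʳ : ∀ {a b} → b ≡ true → a ∨ b ≡ true
  ∨≡true⁺ʳ {a} refl = ∨-zeroʳ a

  ∧-not≡true⁺ : ∀ {a b} → a ≡ true → b ≡ false → a ∧ not b ≡ true
  ∧-not≡true⁺ refl refl = refl

  ∧≡true⁻₃ : ∀ {a b c} → a ∧ b ∧ c ≡ true → a ≡ true × b ≡ true × c ≡ true
  ∧≡true⁻₃ {true} {true} {true} _ = refl , refl , refl

  ∨≡true⁻ : ∀ {a b} → a ∨ b ≡ true → a ≡ true ⊎ b ≡ true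
  ∨≡true⁻ {true}  _ = inj₁ refl
  ∨≡true⁻ {false} h = inj₂ h

  ∧-not≡true⁻ : ∀ {a b} → a ∧ not b ≡ true → a ≡ true × b ≡ false
  ∧-not≡true⁻ {true} {false} _ = refl , refl

  ⌊⌋⇒ : {A : Set} (a? : Dec A) → ⌊ a? ⌋ ≡ true → A
  ⌊⌋⇒ (yes a) _ = a

  ⇒⌊⌋ : {A : Set} (a? : Dec A) → A → ⌊ a? ⌋ ≡ true
  ⇒⌊⌋ (yes _) _ = refl
  ⇒⌊⌋ (no ¬a) a = contradiction a ¬a

  ¬⇒⌊⌋ : {A : Set} (a? : Dec A) → ¬ A → ⌊ a? ⌋ ≡ false
  ¬⇒⌊⌋ (yes a) ¬a = contradiction a ¬a
  ¬⇒⌊⌋ (no _) _ = refl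

-- Opaque, so that the sets in the membership lemmas below are inferred by unification.
opaque
  _∩_ _∪_ _∖_ : Subset m → Subset m → Subset m
  (P ∩ Q) i = P i ∧ Q i
  (P ∪ Q) i = P i ∨ Q i
  (P ∖ Q) i = P i ∧ not (Q i)

  ⁅_⁆ : Fin m → Subset m
  ⁅ v ⁆ i = ⌊ i Fin.≟ v ⌋

  fibre : (Fin m → ℕ) → ℕ → Subset m
  fibre c y i = ⌊ c i ≟ y ⌋

opaque
  unfolding _∩_ _∪_ _∖_ ⁅_⁆ fibre

  ∈∩⁻ : i ∈ₛ P ∩ Q → i ∈ₛ P × i ∈ₛ Q
  ∈∩⁻ = ∧≡true⁻

  ∈∩⁺ : i ∈ₛ P → i ∈ₛ Q → i ∈ₛ P ∩ Q
  ∈∩⁺ p q = ∧≡true⁺ p q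

  ∈∪⁻ : i ∈ₛ P ∪ Q → i ∈ₛ P ⊎ i ∈ₛ Q
  ∈∪⁻ = ∨≡true⁻

  ∈∪⁺ˡ : i ∈ₛ P → i ∈ₛ P ∪ Q
  ∈∪⁺ˡ p = ∨≡true⁺ˡ p

  ∈∪⁺ʳ : i ∈ₛ Q → i ∈ₛ P ∪ Q
  ∈∪⁺ʳ q = ∨≡true⁺ʳ q

  ∈∖⁻ : i ∈ₛ P ∖ Q → i ∈ₛ P × i ∉ₛ Q
  ∈∖⁻ = ∧-not≡true⁻

  ∈∖⁺ : i ∈ₛ P → i ∉ₛ Q → i ∈ₛ P ∖ Q
  ∈∖⁺ p q = ∧-not≡true⁺ p q

  ∪-assoc : (P Q T : Subset m) → (P ∪ Q) ∪ T ≐ P ∪ (Q ∪ T)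
  ∪-assoc P Q T i = ∨-assoc (P i) (Q i) (T i)

  ∖-∪ : (T P Q : Subset m) → T ∖ (P ∪ Q) ≐ (T ∖ P) ∖ Q
  ∖-∪ T P Q i with T i | P i | Q i
  ... | false | _     | _ = refl
  ... | true  | true  | _ = refl
  ... | true  | false | _ = refl

  v∈⁅v⁆ : (v : Fin m) → v ∈ₛ ⁅ v ⁆
  v∈⁅v⁆ v = ⇒⌊⌋ (v Fin.≟ v) refl

  ∈⁅⁆⇒≡ : i ∈ₛ ⁅ v ⁆ → i ≡ v
  ∈⁅⁆⇒≡ {i = i} {v} = ⌊⌋⇒ (i Fin.≟ v)

  ∉⁅⁆ : i ≢ v → i ∉ₛ ⁅ v ⁆
  ∉⁅⁆ {i = i} {v} = ¬⇒⌊⌋ (i Fin.≟ v)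

  ∈fibre⇒≡ : {c : Fin m → ℕ} {y : ℕ} {i : Fin m} → i ∈ₛ fibre c y → c i ≡ y
  ∈fibre⇒≡ {c = c} {y} {i} = ⌊⌋⇒ (c i ≟ y)

  ≡⇒∈fibre : {c : Fin m → ℕ} {y : ℕ} {i : Fin m} → c i ≡ y → i ∈ₛ fibre c y
  ≡⇒∈fibre {c = c} {y} {i} = ⇒⌊⌋ (c i ≟ y)

  colourClass≐fibre : (G : Graph) (c : Fin (n G) → ℕ) (a : ℕ) → colourClass G c a ≐ fibre c a
  colourClass≐fibre G c a i = refl

⟦_⟧ : List (Fin m) → Subset m
⟦ [] ⟧ i = false
⟦ s ∷ ss ⟧ = ⁅ s ⁆ ∪ ⟦ ss ⟧

≡⇒∈⁅⁆ : i ≡ v → i ∈ₛ ⁅ v ⁆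
≡⇒∈⁅⁆ refl = v∈⁅v⁆ _

∈⟦⟧⇒∈ : {ss : List (Fin m)} → i ∈ₛ ⟦ ss ⟧ → i ∈ ss
∈⟦⟧⇒∈ {ss = s ∷ ss} h with ∈∪⁻ h
... | inj₁ i≡s = here (∈⁅⁆⇒≡ i≡s)
... | inj₂ i∈ss = there (∈⟦⟧⇒∈ i∈ss)

∈⇒∈⟦⟧ : {ss : List (Fin m)} → i ∈ ss → i ∈ₛ ⟦ ss ⟧
∈⇒∈⟦⟧ {ss = s ∷ ss} (here refl) = ∈∪⁺ˡ (v∈⁅v⁆ s)
∈⇒∈⟦⟧ {ss = s ∷ ss} (there i∈ss) = ∈∪⁺ʳ (∈⇒∈⟦⟧ i∈ss)

⊆-antisym : P ⊆ Q → Q ⊆ P → P ≐ Q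
⊆-antisym {P = P} {Q} P⊆Q Q⊆P i with P i in Pi | Q i in Qi
... | true  | true  = refl
... | false | false = refl
... | true  | false = contradiction (trans (sym Qi) (P⊆Q i Pi)) λ ()
... | false | true  = contradiction (trans (sym Pi) (Q⊆P i Qi)) λ ()

∖∪-cover : Q ⊆ P → (P ∖ Q) ∪ Q ≐ P
∖∪-cover {Q = Q} {P = P} Q⊆P = ⊆-antisym
  (λ i h → [ proj₁ ∘ ∈∖⁻ , Q⊆P i ]′ (∈∪⁻ h))
  P⊆
  where
  P⊆ : P ⊆ (P ∖ Q) ∪ Q
  P⊆ i i∈P with Q i in i?Q
  ... | true  = ∈∪⁺ʳ i?Q
  ... | false = ∈∪⁺ˡ (∈∖⁺ i∈P i?Q)

∉∖ : i ∈ₛ Q → i ∉ₛ P ∖ Q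
∉∖ i∈Q = ¬-not λ h → not-¬ (proj₂ (∈∖⁻ h)) i∈Q

∩-monoʳ : {Q′ : Subset m} → Q ⊆ Q′ → P ∩ Q ⊆ P ∩ Q′
∩-monoʳ Q⊆Q′ i h = let i∈P , i∈Q = ∈∩⁻ h in ∈∩⁺ i∈P (Q⊆Q′ i i∈Q)

∈∉⇒≢ : i ∈ₛ P → v ∉ₛ P → i ≢ v
∈∉⇒≢ i∈P v∉P refl = not-¬ v∉P i∈P

∈∪⁅⁆⁻ : i ∈ₛ P ∪ ⁅ v ⁆ → i ∈ₛ P ⊎ i ≡ v
∈∪⁅⁆⁻ = map₂ ∈⁅⁆⇒≡ ∘ ∈∪⁻

updateAt-outside : {f : Fin m → ℕ} {g : ℕ → ℕ} → i ∈ₛ P → v ∉ₛ P → updateAt f v g i ≡ f i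
updateAt-outside {i = i} {v = v} i∈P v∉P = updateAt-minimal i v _ (∈∉⇒≢ i∈P v∉P)

module _ {P : Subset m} {i v : Fin m} {c : Fin m → ℕ} {g : ℕ → ℕ} {a : ℕ} (i∈P : i ∈ₛ P) (v∉P : v ∉ₛ P) where

  ∈fibre-updateAt⁻ : i ∈ₛ fibre (updateAt c v g) a → i ∈ₛ fibre c a
  ∈fibre-updateAt⁻ h = ≡⇒∈fibre (trans (sym (updateAt-outside {i = i} i∈P v∉P)) (∈fibre⇒≡ h))

  ∈fibre-updateAt⁺ : i ∈ₛ fibre c a → i ∈ₛ fibre (updateAt c v g) a
  ∈fibre-updateAt⁺ h = ≡⇒∈fibre (trans (updateAt-outside {i = i} i∈P v∉P) (∈fibre⇒≡ h))

opaque
  count : Subset m → ℕ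
  count {zero}  P = 0
  count {suc m} P = if P zero then suc (count (P ∘ suc)) else count (P ∘ suc)

opaque
  unfolding count _∩_

  countF≡count : (P : Subset m) → countF P ≡ count P
  countF≡count P = go P id
    where
    go : ∀ {l m} (P : Subset l) (f : Fin m → Fin l) →
         foldr (λ x acc → if P x then suc acc else acc) 0 (tabulate f) ≡ count (P ∘ f)
    go {m = zero}  P f = refl
    go {m = suc m} P f with P (f zero)
    ... | true  = cong suc (go P (f ∘ suc))
    ... | false = go P (f ∘ suc)

  count-cong : P ≐ Q → count P ≡ count Q
  count-cong {zero}  P≐Q = refl
  count-cong {suc m} {P} {Q} P≐Q rewrite P≐Q zero with Q zero
  ... | true  = cong suc (count-cong (P≐Q ∘ suc))
  ... | false = count-cong (P≐Q ∘ suc)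

  count-mono : P ⊆ Q → count P ≤ count Q
  count-mono {zero}  P⊆Q = z≤n
  count-mono {suc m} {P} {Q} P⊆Q with P zero in P0 | Q zero in Q0
  ... | true  | true  = s≤s (count-mono (P⊆Q ∘ suc))
  ... | false | true  = m≤n⇒m≤1+n (count-mono (P⊆Q ∘ suc))
  ... | false | false = count-mono (P⊆Q ∘ suc)
  ... | true  | false = contradiction (trans (sym (P⊆Q zero P0)) Q0) λ ()

  count≡0 : (∀ i → i ∉ₛ P) → count P ≡ 0
  count≡0 {zero}  P∅ = refl
  count≡0 {suc m} P∅ rewrite P∅ zero = count≡0 (P∅ ∘ suc)

  count-full : count {m} (λ _ → true) ≡ m
  count-full {zero}  = refl
  count-full {suc m} = cong suc count-full

  count>0⇒∈ : 0 < count P → ∃[ i ] i ∈ₛ P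
  count>0⇒∈ {suc m} {P} pos with P zero in P0
  ... | true  = zero , P0
  ... | false with count>0⇒∈ pos
  ...   | i , i∈P = suc i , i∈P

  ∈⇒count>0 : i ∈ₛ P → 0 < count P
  ∈⇒count>0 {suc m} {zero}  {P} i∈P rewrite i∈P = s≤s z≤n
  ∈⇒count>0 {suc m} {suc i} {P} i∈P with P zero
  ... | true  = s≤s z≤n
  ... | false = ∈⇒count>0 {i = i} i∈P

  count-split : (P Q : Subset m) → count P ≡ count (P ∩ Q) + count (P ∖ Q)
  count-split {zero}  P Q = refl
  count-split {suc m} P Q with P zero | Q zero | count-split (P ∘ suc) (Q ∘ suc)
  ... | true  | true  | ih = cong suc ih
  ... | true  | false | ih = trans (cong suc ih) (sym (+-suc _ _))
  ... | false | _     | ih = ih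

  count⁅⁆ : (v : Fin m) → count ⁅ v ⁆ ≡ 1
  count⁅⁆ {suc m} zero rewrite v∈⁅v⁆ {m = suc m} zero =
    cong suc (count≡0 {P = λ (i : Fin m) → ⁅ zero ⁆ (suc i)} λ i → ∉⁅⁆ {i = suc i} {v = zero} λ ())
  count⁅⁆ {suc m} (suc v) rewrite ∉⁅⁆ {i = zero} {v = suc v} λ () =
    trans (count-cong {P = ⁅ suc v ⁆ ∘ suc} (⊆-antisym (λ i h → ≡⇒∈⁅⁆ (Finₚ.suc-injective (∈⁅⁆⇒≡ h)))
                                  (λ i h → ≡⇒∈⁅⁆ (cong suc (∈⁅⁆⇒≡ h)))))
          (count⁅⁆ v)

count-remove : v ∈ₛ P → count P ≡ suc (count (P ∖ ⁅ v ⁆))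
count-remove {v = v} {P = P} v∈P = begin
  count P                                      ≡⟨ count-split P ⁅ v ⁆ ⟩
  count (P ∩ ⁅ v ⁆) + count (P ∖ ⁅ v ⁆)        ≡⟨ cong (_+ count (P ∖ ⁅ v ⁆)) P∩⁅v⁆≡1 ⟩
  suc (count (P ∖ ⁅ v ⁆))                      ∎
  where
  open ≡-Reasoning
  P∩⁅v⁆≡1 : count (P ∩ ⁅ v ⁆) ≡ 1
  P∩⁅v⁆≡1 = trans (count-cong (⊆-antisym (λ i → proj₂ ∘ ∈∩⁻)
                                         (λ i i≡v → ∈∩⁺ (subst (_∈ₛ P) (sym (∈⁅⁆⇒≡ i≡v)) v∈P) i≡v)))
                  (count⁅⁆ v)

count≤1⇒≡ : count P ≤ 1 → AtMostOne P
count≤1⇒≡ ≤1 i v i∈P v∈P with i Fin.≟ v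
... | yes i≡v = i≡v
... | no  i≢v = contradiction (subst (_≤ 1) (count-remove i∈P) ≤1)
                  (<⇒≱ (s≤s (∈⇒count>0 (∈∖⁺ v∈P (∉⁅⁆ (i≢v ∘ sym))))))

count≤1 : AtMostOne P → count P ≤ 1
count≤1 {P = P} unique with count P in e
... | zero  = z≤n
... | suc c with count>0⇒∈ {P = P} (subst (0 <_) (sym e) (s≤s z≤n))
...   | i , i∈P = ≤-reflexive (begin
  suc c                   ≡⟨ sym e ⟩
  count P                 ≡⟨ count-remove i∈P ⟩
  suc (count (P ∖ ⁅ i ⁆)) ≡⟨ cong suc (count≡0 only-i) ⟩
  1                       ∎)
  where
  open ≡-Reasoning
  only-i : ∀ j → j ∉ₛ P ∖ ⁅ i ⁆
  only-i j = ¬-not λ j∈ → let j∈P , j∉⁅i⁆ = ∈∖⁻ j∈ in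
    not-¬ j∉⁅i⁆ (≡⇒∈⁅⁆ (unique j i j∈P i∈P))

count-∪⁅⁆≤ : (P : Subset m) (v : Fin m) → count (P ∪ ⁅ v ⁆) ≤ suc (count P)
count-∪⁅⁆≤ P v = begin
  count (P ∪ ⁅ v ⁆)                                  ≡⟨ count-split (P ∪ ⁅ v ⁆) ⁅ v ⁆ ⟩
  count ((P ∪ ⁅ v ⁆) ∩ ⁅ v ⁆) + count ((P ∪ ⁅ v ⁆) ∖ ⁅ v ⁆)
    ≤⟨ +-mono-≤ (≤-trans (count-mono λ i → proj₂ ∘ ∈∩⁻) (≤-reflexive (count⁅⁆ v)))
                (count-mono λ i h → let i∈ , i∉⁅v⁆ = ∈∖⁻ h in [ id , (λ i∈⁅v⁆ → contradiction i∈⁅v⁆ (not-¬ i∉⁅v⁆)) ]′ (∈∪⁻ i∈)) ⟩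
  suc (count P)                                      ∎
  where open ≤-Reasoning

count-∖⟦⟧ : {ss : List (Fin m)} → Unique ss → ⟦ ss ⟧ ⊆ P →
            count (P ∖ ⟦ ss ⟧) + length ss ≡ count P
count-∖⟦⟧ {P = P} {[]} [] _ = begin
  count (P ∖ ⟦ [] ⟧) + 0 ≡⟨ +-identityʳ _ ⟩
  count (P ∖ ⟦ [] ⟧)     ≡⟨ count-cong (⊆-antisym (λ i → proj₁ ∘ ∈∖⁻) (λ i i∈P → ∈∖⁺ i∈P refl)) ⟩
  count P                ∎
  where open ≡-Reasoning
count-∖⟦⟧ {P = P} {s ∷ ss} (s∉ss ∷ ss!) ss⊆P = begin
  count (P ∖ ⟦ s ∷ ss ⟧) + suc (length ss)       ≡⟨ cong (_+ suc (length ss)) (count-cong (∖-∪ P ⁅ s ⁆ ⟦ ss ⟧)) ⟩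
  count (P ∖ ⁅ s ⁆ ∖ ⟦ ss ⟧) + suc (length ss)   ≡⟨ +-suc _ _ ⟩
  suc (count (P ∖ ⁅ s ⁆ ∖ ⟦ ss ⟧) + length ss)   ≡⟨ cong suc (count-∖⟦⟧ ss! ss⊆P∖s) ⟩
  suc (count (P ∖ ⁅ s ⁆))                        ≡⟨ sym (count-remove (ss⊆P s (∈∪⁺ˡ (v∈⁅v⁆ s)))) ⟩
  count P                                        ∎
  where
  open ≡-Reasoning
  ss⊆P∖s : ⟦ ss ⟧ ⊆ P ∖ ⁅ s ⁆
  ss⊆P∖s i i∈ss = ∈∖⁺ (ss⊆P i (∈∪⁺ʳ i∈ss)) (∉⁅⁆ λ i≡s → All.lookup s∉ss (∈⟦⟧⇒∈ i∈ss) (sym i≡s))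

count≤-injection : (f : Fin m → ℕ) (B : ℕ) →
                   (∀ i j → i ∈ₛ P → j ∈ₛ P → f i ≡ f j → i ≡ j) →
                   (∀ i → i ∈ₛ P → f i < B) → count P ≤ B
count≤-injection f zero    _   f<B = ≤-reflexive (count≡0 λ i → ¬-not λ i∈P → contradiction (f<B i i∈P) λ ())
count≤-injection {P = P} f (suc B) inj f<B = begin
  count P                                        ≡⟨ count-split P (fibre f B) ⟩
  count (P ∩ fibre f B) + count (P ∖ fibre f B)  ≤⟨ +-mono-≤ (count≤1 on-fibre) (count≤-injection f B off-inj off-fibre) ⟩
  1 + B                                          ∎
  where
  open ≤-Reasoning
  on-fibre : AtMostOne (P ∩ fibre f B)
  on-fibre i j i∈ j∈ = let i∈P , fi≡B = ∈∩⁻ i∈ ; j∈P , fj≡B = ∈∩⁻ j∈ in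
    inj i j i∈P j∈P (trans (∈fibre⇒≡ fi≡B) (sym (∈fibre⇒≡ fj≡B)))
  off-inj : ∀ i j → i ∈ₛ P ∖ fibre f B → j ∈ₛ P ∖ fibre f B → f i ≡ f j → i ≡ j
  off-inj i j i∈ j∈ = inj i j (proj₁ (∈∖⁻ i∈)) (proj₁ (∈∖⁻ j∈))
  off-fibre : ∀ i → i ∈ₛ P ∖ fibre f B → f i < B
  off-fibre i i∈ = let i∈P , fi≢B = ∈∖⁻ i∈ in
    ≤∧≢⇒< (≤-pred (f<B i i∈P)) (not-¬ fi≢B ∘ ≡⇒∈fibre)

count≤2⇒∃count∖⁅⁆≤1 : count P ≤ 2 → P ⊆ Q → 0 < count Q → ∃[ u ] u ∈ₛ Q × count (P ∖ ⁅ u ⁆) ≤ 1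
count≤2⇒∃count∖⁅⁆≤1 {P = P} P≤2 P⊆Q Q≢∅ with count P in e
... | zero = let u , u∈Q = count>0⇒∈ Q≢∅ in
  u , u∈Q , ≤-trans (count-mono λ i → proj₁ ∘ ∈∖⁻) (≤-trans (≤-reflexive e) z≤n)
... | suc c = let u , u∈P = count>0⇒∈ {P = P} (subst (0 <_) (sym e) (s≤s z≤n)) in
  u , P⊆Q u u∈P , ≤-pred (subst (_≤ 2) (count-remove u∈P) (subst (_≤ 2) (sym e) P≤2))

∖fibre∩fibre : (c : Fin m → ℕ) {y y′ : ℕ} → y′ ≢ y → (P ∖ fibre c y) ∩ fibre c y′ ≐ P ∩ fibre c y′
∖fibre∩fibre c y′≢y = ⊆-antisym
  (λ i h → let i∈P∖ , i∈y′ = ∈∩⁻ h in ∈∩⁺ (proj₁ (∈∖⁻ i∈P∖)) i∈y′)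
  (λ i h → let i∈P , i∈y′ = ∈∩⁻ h in
     ∈∩⁺ (∈∖⁺ i∈P (¬-not λ i∈y → y′≢y (trans (sym (∈fibre⇒≡ i∈y′)) (∈fibre⇒≡ i∈y)))) i∈y′)

rarely-used-colour : (c : Fin m → ℕ) (N E : Subset m) (ys : List ℕ) → Unique ys →
  count N + 2 * count E < 2 * length ys →
  ∃[ y ] y ∈ ys × count (N ∩ fibre c y) + 2 * count (E ∩ fibre c y) ≤ 1
rarely-used-colour c N E (y ∷ ys) (y∉ys ∷ ys!) bound
  with count (N ∩ fibre c y) + 2 * count (E ∩ fibre c y) ≤? 1
... | yes few = y , here refl , few
... | no many with rarely-used-colour c (N ∖ fibre c y) (E ∖ fibre c y) ys ys! rest-bound
  where
  rest-bound : count (N ∖ fibre c y) + 2 * count (E ∖ fibre c y) < 2 * length ys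
  rest-bound = +-cancelˡ-< 2 _ _ (begin-strict
    2 + (count N′ + 2 * count E′)
      ≤⟨ +-monoˡ-≤ _ (≰⇒> many) ⟩
    (count (N ∩ fibre c y) + 2 * count (E ∩ fibre c y)) + (count N′ + 2 * count E′)
      ≡⟨ regroup (count (N ∩ fibre c y)) (count (E ∩ fibre c y)) (count N′) (count E′) ⟩
    (count (N ∩ fibre c y) + count N′) + 2 * (count (E ∩ fibre c y) + count E′)
      ≡⟨ sym (cong₂ (λ a b → a + 2 * b) (count-split N (fibre c y)) (count-split E (fibre c y))) ⟩
    count N + 2 * count E
      <⟨ bound ⟩
    2 * suc (length ys)
      ≡⟨ *-suc 2 (length ys) ⟩
    2 + 2 * length ys ∎)
    where
    open ≤-Reasoning
    N′ E′ : Subset _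
    N′ = N ∖ fibre c y
    E′ = E ∖ fibre c y
    regroup : ∀ a b c d → (a + 2 * b) + (c + 2 * d) ≡ (a + c) + 2 * (b + d)
    regroup = solve-∀
...   | y′ , y′∈ys , few = y′ , there y′∈ys ,
          subst (_≤ 1) (cong₂ (λ a b → a + 2 * b) (count-cong (∖fibre∩fibre c y′≢y))
                                                  (count-cong (∖fibre∩fibre c y′≢y))) few
  where
  y′≢y : y′ ≢ y
  y′≢y y′≡y = All.lookup y∉ys y′∈ys (sym y′≡y)

module _ {G : Graph} where

  forest-⊆ : P ⊆ Q → InducesForest G Q → InducesForest G P
  forest-⊆ P⊆Q Q-forest C on-P = Q-forest C (λ i → P⊆Q _ (on-P i))

  forest-∅ : (∀ v → v ∉ₛ P) → InducesForest G P
  forest-∅ P∅ C on-P = not-¬ (P∅ (vtx C zero)) (on-P zero)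

  cycle-neighbours : (C : Cycle G) (i : Fin (3 + len C)) → ∃[ p ] ∃[ q ] p ≢ q ×
    adj G (vtx C i) (vtx C p) ≡ true × adj G (vtx C i) (vtx C q) ≡ true
  cycle-neighbours C zero = Fin.fromℕ _ , suc zero , (λ ()) ,
    trans (Graph.sym G _ _) (close C) , step C zero
  cycle-neighbours C (suc i) with Top.view i
  ... | Top.‵fromℕ = inject₁ i , zero , (λ ()) , trans (Graph.sym G _ _) (step C i) , close C
  ... | Top.‵inject₁ j = inject₁ (inject₁ j) , suc (suc j) , inject₁²≢suc² j ,
    trans (Graph.sym G _ _) (step C (inject₁ j)) , step C (suc j)
    where
    inject₁²≢suc² : ∀ {l} (j : Fin l) → inject₁ (inject₁ j) ≢ suc (suc j)
    inject₁²≢suc² zero    ()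
    inject₁²≢suc² (suc j) eq = inject₁²≢suc² j (Finₚ.suc-injective eq)

  forest-insert : InducesForest G P → AtMostOne (adj G v ∩ P) → InducesForest G (P ∪ ⁅ v ⁆)
  forest-insert {P = P} {v = v} P-forest one-neighbour C on-P∪v
    with Finₚ.any? (λ i → vtx C i Fin.≟ v)
  ... | no v∉C = P-forest C λ i → [ id , (λ i∈⁅v⁆ → contradiction (i , ∈⁅⁆⇒≡ i∈⁅v⁆) v∉C) ]′ (∈∪⁻ (on-P∪v i))
  ... | yes (i , refl) with cycle-neighbours C i
  ...   | p , q , p≢q , adj-p , adj-q = p≢q (inj C (one-neighbour _ _ (neighbour p adj-p) (neighbour q adj-q)))
    where
    neighbour : ∀ j → adj G (vtx C i) (vtx C j) ≡ true → vtx C j ∈ₛ adj G (vtx C i) ∩ P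
    neighbour j adj-j = ∈∩⁺ adj-j ([ id , (λ j∈⁅v⁆ → contradiction (subst (λ w → adj G (vtx C i) w ≡ true) (∈⁅⁆⇒≡ j∈⁅v⁆) adj-j)
                                                    (not-¬ (Graph.irrefl G (vtx C i)))) ]′ (∈∪⁻ (on-P∪v j)))

  forest-insert-coloured : {R : Subset (n G)} {c : Fin (n G) → ℕ} {y : ℕ} → v ∉ₛ R →
    (∀ a → InducesForest G (R ∩ fibre c a)) → AtMostOne (adj G v ∩ (R ∩ fibre c y)) →
    ∀ a → InducesForest G ((R ∪ ⁅ v ⁆) ∩ fibre (updateAt c v (const y)) a)
  forest-insert-coloured {v = v} {R} {c} {y} v∉R R-forest one-neighbour a with a ≟ y
  ... | yes refl = forest-⊆ (λ u h → let u∈R∪v , u∈a = ∈∩⁻ h in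
        [ (λ u∈R → ∈∪⁺ˡ (∈∩⁺ u∈R (∈fibre-updateAt⁻ {i = u} u∈R v∉R u∈a))) , ∈∪⁺ʳ ∘ ≡⇒∈⁅⁆ ]′ (∈∪⁅⁆⁻ u∈R∪v))
      (forest-insert (R-forest y) one-neighbour)
  ... | no a≢y = forest-⊆ (λ u h → let u∈R∪v , u∈a = ∈∩⁻ h in
        [ (λ u∈R → ∈∩⁺ u∈R (∈fibre-updateAt⁻ {i = u} u∈R v∉R u∈a))
        , (λ { refl → ⊥-elim (a≢y (trans (sym (∈fibre⇒≡ u∈a)) (updateAt-updates u c))) }) ]′ (∈∪⁅⁆⁻ u∈R∪v))
      (R-forest a)

  induced : Subset (n G) → Subgraph G
  induced T = record
    { S = T
    ; H = λ u w → T u ∧ adj G u w ∧ T w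
    ; H-sym = λ u w → trans (cong (λ a → T u ∧ a ∧ T w) (Graph.sym G u w)) (∧-swap (T u) (adj G w u) (T w))
    ; H⊆E = λ u w h → proj₁ (proj₂ (∧≡true⁻₃ {T u} {adj G u w} h))
    ; H-inS = λ u w h → proj₁ (∧≡true⁻ {T u} h)
    }
    where
    ∧-swap : ∀ a b c → a ∧ b ∧ c ≡ c ∧ b ∧ a
    ∧-swap true  b true  = refl
    ∧-swap true  b false = ∧-zeroʳ b
    ∧-swap false b true  = sym (∧-zeroʳ b)
    ∧-swap false b false = refl

  neighbours⊆ : (x : Fin (n G)) → adj G x ∩ P ⊆ P ∖ ⁅ x ⁆
  neighbours⊆ x w h = let xw , w∈P = ∈∩⁻ h in
    ∈∖⁺ w∈P (∉⁅⁆ λ { refl → not-¬ (Graph.irrefl G w) xw })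

  low-degree-vertex : Degenerate 2 G → (T : Subset (n G)) → 0 < count T →
                      ∃[ x ] x ∈ₛ T × count (adj G x ∩ T) ≤ 2
  low-degree-vertex degenerate T T≢∅ with degenerate (induced T) (count>0⇒∈ T≢∅)
  ... | x , x∈T , deg≤2 = x , x∈T , subst (_≤ 2) (trans (countF≡count _) (count-cong H-x≐)) deg≤2
    where
    H-x≐ : Subgraph.H (induced T) x ≐ adj G x ∩ T
    H-x≐ = ⊆-antisym (λ w h → let _ , xw , w∈T = ∧≡true⁻₃ {T x} {adj G x w} h in ∈∩⁺ xw w∈T)
                     (λ w h → let xw , w∈T = ∈∩⁻ h in ∧≡true⁺ x∈T (∧≡true⁺ xw w∈T))

  peel : Degenerate 2 G → (t : ℕ) (T : Subset (n G)) → t ≤ count T →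
    ∃[ ms ] length ms ≡ t × Unique ms × ⟦ ms ⟧ ⊆ T × All (λ u → count (adj G u ∩ (T ∖ ⟦ ms ⟧)) ≤ 2) ms
  peel _          zero    T _ = [] , refl , [] , (λ _ ()) , []
  peel degenerate (suc t) T t<T with low-degree-vertex degenerate T (≤-trans (s≤s z≤n) t<T)
  ... | x , x∈T , deg≤2 with peel degenerate t (T ∖ ⁅ x ⁆) (≤-pred (subst (suc t ≤_) (count-remove x∈T) t<T))
  ...   | ms , length≡ , ms! , ms⊆ , sparse =
    x ∷ ms , cong suc length≡ , All.tabulate x∉ms ∷ ms! , x∷ms⊆T ,
    ≤-trans (count-mono λ u h → let xu , u∈ = ∈∩⁻ h in ∈∩⁺ xu (proj₁ (∈∖⁻ u∈))) deg≤2 ∷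
    All.map (≤-trans (count-mono λ u h → let wu , u∈ = ∈∩⁻ h in ∈∩⁺ wu (trans (sym (∖-∪ T ⁅ x ⁆ ⟦ ms ⟧ u)) u∈))) sparse
    where
    x∉ms : ∀ {u} → u ∈ ms → x ≢ u
    x∉ms u∈ms x≡u = not-¬ (proj₂ (∈∖⁻ (ms⊆ _ (∈⇒∈⟦⟧ u∈ms)))) (≡⇒∈⁅⁆ (sym x≡u))
    x∷ms⊆T : ⟦ x ∷ ms ⟧ ⊆ T
    x∷ms⊆T u h = [ (λ u∈x → subst (_∈ₛ T) (sym (∈⁅⁆⇒≡ u∈x)) x∈T) , (λ u∈ms → proj₁ (∈∖⁻ (ms⊆ u u∈ms))) ]′ (∈∪⁻ h)

-- The hypothesis on s says that a block of size s is either full (s = k) or all that is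
-- left (r = 0).
ceilDiv-step : ∀ r s k → 0 < s → (r + s) ⊓ k ≡ s → suc (ceilDiv r k) ≤ ceilDiv (r + s) k
ceilDiv-step r s zero     0<s eq = contradiction (trans (sym eq) (⊓-zeroʳ (r + s))) (>⇒≢ 0<s)
ceilDiv-step r s (suc k′) 0<s eq with r + s ≤? suc k′
... | yes fits = begin
  suc ((r + k′) / suc k′) ≡⟨ cong (λ x → suc ((x + k′) / suc k′)) r≡0 ⟩
  suc (k′ / suc k′)       ≡⟨ cong suc (m<n⇒m/n≡0 (n<1+n k′)) ⟩
  1                       ≤⟨ m≥n⇒m/n>0 {n = suc k′} (+-monoˡ-≤ k′ (≤-trans 0<s (m≤n+m s r))) ⟩
  (r + s + k′) / suc k′   ∎
  where
  open ≤-Reasoning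
  r≡0 : r ≡ 0
  r≡0 = +-cancelʳ-≡ s r 0 (trans (sym (m≤n⇒m⊓n≡m fits)) eq)
... | no overflows = ≤-reflexive (begin
  suc ((r + k′) / suc k′)                 ≡⟨ +-comm 1 _ ⟩
  (r + k′) / suc k′ + 1                   ≡⟨ cong ((r + k′) / suc k′ +_) (sym (n/n≡1 (suc k′))) ⟩
  (r + k′) / suc k′ + suc k′ / suc k′     ≡⟨ sym (+-distrib-/-∣ʳ (r + k′) ∣-refl) ⟩
  (r + k′ + suc k′) / suc k′              ≡⟨ cong (_/ suc k′) (regroup r k′) ⟩
  (r + suc k′ + k′) / suc k′              ≡⟨ cong (λ x → (r + x + k′) / suc k′) (sym s≡k) ⟩
  (r + s + k′) / suc k′                   ∎)
  where
  open ≡-Reasoning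
  s≡k : s ≡ suc k′
  s≡k = trans (sym eq) (m≥n⇒m⊓n≡n (<⇒≤ (≰⇒> overflows)))
  regroup : ∀ r k′ → r + k′ + suc k′ ≡ r + suc k′ + k′
  regroup = solve-∀

module _ {T : Subset m} {u x : Fin m} {ms : List (Fin m)}
         (u∈T : u ∈ₛ T) (x∈T : x ∈ₛ T) (ms⊆ : ⟦ ms ⟧ ⊆ T ∖ ⁅ x ⁆ ∖ ⁅ u ⁆) where

  private
    ms⊆T∖x∖u : ∀ {v} → v ∈ ms → v ∈ₛ T ∖ ⁅ x ⁆ ∖ ⁅ u ⁆
    ms⊆T∖x∖u v∈ms = ms⊆ _ (∈⇒∈⟦⟧ v∈ms)

  sandwich-unique : u ≢ x → Unique ms → Unique (u ∷ ms ++ x ∷ [])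
  sandwich-unique u≢x ms! =
    Allₚ.++⁺ (All.tabulate λ v∈ms u≡v → not-¬ (proj₂ (∈∖⁻ (ms⊆T∖x∖u v∈ms))) (≡⇒∈⁅⁆ (sym u≡v))) (u≢x ∷ [])
    ∷ Uniqueₚ.++⁺ ms! ([] ∷ []) λ { (x∈ms , here refl) →
        not-¬ (proj₂ (∈∖⁻ (proj₁ (∈∖⁻ (ms⊆T∖x∖u x∈ms))))) (v∈⁅v⁆ x) }

  sandwich-⊆ : ⟦ u ∷ ms ++ x ∷ [] ⟧ ⊆ T
  sandwich-⊆ v h with ∈⟦⟧⇒∈ h
  ... | here refl = u∈T
  ... | there v∈ms++x with ∈-++⁻ ms v∈ms++x
  ...   | inj₁ v∈ms = proj₁ (∈∖⁻ (proj₁ (∈∖⁻ (ms⊆T∖x∖u v∈ms))))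
  ...   | inj₂ (here refl) = x∈T

  sandwich-rest : T ∖ ⟦ u ∷ ms ++ x ∷ [] ⟧ ⊆ T ∖ ⁅ x ⁆ ∖ ⁅ u ⁆ ∖ ⟦ ms ⟧
  sandwich-rest v h = ∈∖⁺ (∈∖⁺ (∈∖⁺ (proj₁ (∈∖⁻ h)) (∉⁅⁆ λ { refl → non-member (there (∈-++⁺ʳ ms (here refl))) }))
                               (∉⁅⁆ λ { refl → non-member (here refl) }))
                          (¬-not λ v∈ms → non-member (there (∈-++⁺ˡ (∈⟦⟧⇒∈ {ss = ms} v∈ms))))
    where
    non-member : v ∉ u ∷ ms ++ x ∷ []
    non-member = not-¬ (proj₂ (∈∖⁻ h)) ∘ ∈⇒∈⟦⟧

module Construction (G : Graph) (degenerate : Degenerate 2 G)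
  (k : ℕ) .{{_ : NonZero k}} (degree< : ∀ v → count (adj G v) < 2 * k)
  (L : Fin (n G) → List ℕ) (L-length : ∀ v → length (L v) ≡ k) (L-unique : ∀ v → Unique (L v)) where

  private
    V : Set
    V = Fin (n G)

    variable
      Old R T : Subset (n G)

  record Colouring (R : Subset (n G)) (B : ℕ) : Set where
    field
      colour block     : V → ℕ
      colour∈L         : ∀ v → v ∈ₛ R → colour v ∈ L v
      block<           : ∀ v → v ∈ₛ R → block v < B
      distinct-in-block : ∀ u v → u ∈ₛ R → v ∈ₛ R → block u ≡ block v → colour u ≡ colour v → u ≡ v
      forest           : ∀ a → InducesForest G (R ∩ fibre colour a)
  open Colouring

  colouring-∅ : (∀ v → v ∉ₛ R) → Colouring R 0
  colouring-∅ R∅ = record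
    { colour = λ _ → 0 ; block = λ _ → 0
    ; colour∈L = λ v v∈R → contradiction v∈R (not-¬ (R∅ v))
    ; block< = λ v v∈R → contradiction v∈R (not-¬ (R∅ v))
    ; distinct-in-block = λ u v u∈R → contradiction u∈R (not-¬ (R∅ u))
    ; forest = λ a → forest-∅ λ v → ¬-not (not-¬ (R∅ v) ∘ proj₁ ∘ ∈∩⁻)
    }

  colouring-cong : R ≐ T → Colouring R B → Colouring T B
  colouring-cong {R = R} {T = T} R≐T I = record
    { colour = colour I ; block = block I
    ; colour∈L = λ v → colour∈L I v ∘ T⊆R v
    ; block< = λ v → block< I v ∘ T⊆R v
    ; distinct-in-block = λ u v u∈T v∈T → distinct-in-block I u v (T⊆R u u∈T) (T⊆R v v∈T)
    ; forest = λ a → forest-⊆ (λ v h → let v∈T , v∈a = ∈∩⁻ h in ∈∩⁺ (T⊆R v v∈T) v∈a) (forest I a)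
    }
    where
    T⊆R : T ⊆ R
    T⊆R v v∈T = trans (R≐T v) v∈T

  colouring-≤ : B ≤ B′ → Colouring R B → Colouring R B′
  colouring-≤ B≤B′ I = record
    { colour = colour I ; block = block I ; colour∈L = colour∈L I
    ; block< = λ v v∈R → ≤-trans (block< I v v∈R) B≤B′
    ; distinct-in-block = distinct-in-block I ; forest = forest I
    }

  extend : (I : Colouring R B) {v : V} → v ∉ₛ R → {y β : ℕ} → y ∈ L v → β < B →
    (∀ u → u ∈ₛ R → block I u ≡ β → colour I u ≢ y) →
    AtMostOne (adj G v ∩ (R ∩ fibre (colour I) y)) →
    Colouring (R ∪ ⁅ v ⁆) B
  extend {R = R} {B = B} I {v} v∉R {y} {β} y∈L β<B fresh-in-block one-neighbour = record
    { colour = colour′ ; block = block′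
    ; colour∈L = colour′∈L ; block< = block′< ; distinct-in-block = distinct′
    ; forest = forest-insert-coloured v∉R (forest I) one-neighbour
    }
    where
    colour′ block′ : V → ℕ
    colour′ = updateAt (colour I) v (const y)
    block′ = updateAt (block I) v (const β)

    unchanged : ∀ {f : V → ℕ} {z} u → u ∈ₛ R → updateAt f v (const z) u ≡ f u
    unchanged u u∈R = updateAt-outside {i = u} u∈R v∉R

    at-v : ∀ {f : V → ℕ} {z} → updateAt f v (const z) v ≡ z
    at-v = updateAt-updates v _

    colour′∈L : ∀ u → u ∈ₛ R ∪ ⁅ v ⁆ → colour′ u ∈ L u
    colour′∈L u h with ∈∪⁅⁆⁻ h
    ... | inj₁ u∈R = subst (_∈ L u) (sym (unchanged u u∈R)) (colour∈L I u u∈R)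
    ... | inj₂ refl = subst (_∈ L u) (sym at-v) y∈L

    block′< : ∀ u → u ∈ₛ R ∪ ⁅ v ⁆ → block′ u < B
    block′< u h with ∈∪⁅⁆⁻ h
    ... | inj₁ u∈R = subst (_< B) (sym (unchanged u u∈R)) (block< I u u∈R)
    ... | inj₂ refl = subst (_< B) (sym at-v) β<B

    unlike-v : ∀ u → u ∈ₛ R → block′ u ≡ block′ v → colour′ u ≡ colour′ v → ⊥
    unlike-v u u∈R eb ec = fresh-in-block u u∈R (trans (sym (unchanged u u∈R)) (trans eb at-v))
                                              (trans (sym (unchanged u u∈R)) (trans ec at-v))

    distinct′ : ∀ u w → u ∈ₛ R ∪ ⁅ v ⁆ → w ∈ₛ R ∪ ⁅ v ⁆ → block′ u ≡ block′ w → colour′ u ≡ colour′ w → u ≡ w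
    distinct′ u w hu hw eb ec with ∈∪⁅⁆⁻ hu | ∈∪⁅⁆⁻ hw
    ... | inj₁ u∈R | inj₁ w∈R = distinct-in-block I u w u∈R w∈R
      (trans (sym (unchanged u u∈R)) (trans eb (unchanged w w∈R)))
      (trans (sym (unchanged u u∈R)) (trans ec (unchanged w w∈R)))
    ... | inj₁ u∈R | inj₂ refl = ⊥-elim (unlike-v u u∈R eb ec)
    ... | inj₂ refl | inj₁ w∈R = ⊥-elim (unlike-v w w∈R (sym eb) (sym ec))
    ... | inj₂ refl | inj₂ refl = refl

  record OpenBlock (Old R : Subset (n G)) (b j : ℕ) : Set where
    field
      colouring     : Colouring R (suc b)
      below-top⊆Old : R ∖ fibre (block colouring) b ⊆ Old
      top-size      : count (R ∩ fibre (block colouring) b) ≤ j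
  open OpenBlock

  open-block : Colouring R b → OpenBlock R R b 0
  open-block {R = R} {b = b} I = record
    { colouring = colouring-≤ (n≤1+n b) I
    ; below-top⊆Old = λ v → proj₁ ∘ ∈∖⁻
    ; top-size = ≤-reflexive (count≡0 λ v → ¬-not λ h →
        let v∈R , v∈b = ∈∩⁻ h in <-irrefl (∈fibre⇒≡ v∈b) (block< I v v∈R))
    }

  add-coloured-vertex : (S : OpenBlock Old R b j) → v ∉ₛ R → {y : ℕ} → y ∈ L v →
    (∀ u → u ∈ₛ R → block (colouring S) u ≡ b → colour (colouring S) u ≢ y) →
    AtMostOne (adj G v ∩ (R ∩ fibre (colour (colouring S)) y)) →
    OpenBlock Old (R ∪ ⁅ v ⁆) b (suc j)
  add-coloured-vertex {Old = Old} {R = R} {b = b} {j = j} {v = v} S v∉R y∈L fresh one-neighbour = record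
    { colouring = I′ ; below-top⊆Old = below-top⊆Old′ ; top-size = top-size′ }
    where
    I′ : Colouring (R ∪ ⁅ v ⁆) (suc b)
    I′ = extend (colouring S) v∉R y∈L (n<1+n b) fresh one-neighbour

    below-top⊆Old′ : (R ∪ ⁅ v ⁆) ∖ fibre (block I′) b ⊆ Old
    below-top⊆Old′ u h with ∈∖⁻ h
    ... | u∈R∪v , u∉b with ∈∪⁅⁆⁻ u∈R∪v
    ...   | inj₁ u∈R = below-top⊆Old S u (∈∖⁺ u∈R (¬-not (not-¬ u∉b ∘ ∈fibre-updateAt⁺ {i = u} u∈R v∉R)))
    ...   | inj₂ refl = contradiction (≡⇒∈fibre (updateAt-updates u (block (colouring S)))) (not-¬ u∉b)

    top-size′ : count ((R ∪ ⁅ v ⁆) ∩ fibre (block I′) b) ≤ suc j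
    top-size′ = begin
      count ((R ∪ ⁅ v ⁆) ∩ fibre (block I′) b)          ≤⟨ count-mono new-top⊆ ⟩
      count (R ∩ fibre (block (colouring S)) b ∪ ⁅ v ⁆) ≤⟨ count-∪⁅⁆≤ _ v ⟩
      suc (count (R ∩ fibre (block (colouring S)) b))   ≤⟨ s≤s (top-size S) ⟩
      suc j                                             ∎
      where
      open ≤-Reasoning
      new-top⊆ : (R ∪ ⁅ v ⁆) ∩ fibre (block I′) b ⊆ R ∩ fibre (block (colouring S)) b ∪ ⁅ v ⁆
      new-top⊆ u h with ∈∩⁻ h
      ... | u∈R∪v , u∈b with ∈∪⁅⁆⁻ u∈R∪v
      ...   | inj₁ u∈R = ∈∪⁺ˡ (∈∩⁺ u∈R (∈fibre-updateAt⁻ {i = u} u∈R v∉R u∈b))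
      ...   | inj₂ u≡v = ∈∪⁺ʳ (≡⇒∈⁅⁆ u≡v)

  add-vertex : OpenBlock Old R b j → v ∉ₛ R → count (adj G v ∩ Old) + 2 * j < 2 * k →
               OpenBlock Old (R ∪ ⁅ v ⁆) b (suc j)
  add-vertex {Old = Old} {R = R} {b = b} {j = j} {v = v} S v∉R room =
    choose (rarely-used-colour (colour I) outside top (L v) (L-unique v) weight<)
    where
    I : Colouring R (suc b)
    I = colouring S
    top outside : Subset (n G)
    top = R ∩ fibre (block I) b
    outside = adj G v ∩ (R ∖ fibre (block I) b)

    weight< : count outside + 2 * count top < 2 * length (L v)
    weight< = begin-strict
      count outside + 2 * count top
        ≤⟨ +-mono-≤ (count-mono (∩-monoʳ (below-top⊆Old S))) (*-monoʳ-≤ 2 (top-size S)) ⟩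
      count (adj G v ∩ Old) + 2 * j <⟨ room ⟩
      2 * k                         ≡⟨ cong (2 *_) (L-length v) ⟨
      2 * length (L v)              ∎
      where open ≤-Reasoning

    choose : ∃[ y ] y ∈ L v × count (outside ∩ fibre (colour I) y) + 2 * count (top ∩ fibre (colour I) y) ≤ 1 →
             OpenBlock Old (R ∪ ⁅ v ⁆) b (suc j)
    choose (y , y∈L , few) = add-coloured-vertex S v∉R y∈L fresh one-neighbour
      where
      fresh : ∀ u → u ∈ₛ R → block I u ≡ b → colour I u ≢ y
      fresh u u∈R bu≡b cu≡y = <-irrefl (sym (double≤1 _ (m+n≤o⇒n≤o (count (outside ∩ fibre (colour I) y)) few)))
        (∈⇒count>0 {i = u} (∈∩⁺ (∈∩⁺ u∈R (≡⇒∈fibre bu≡b)) (≡⇒∈fibre cu≡y)))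
        where
        double≤1 : ∀ e → 2 * e ≤ 1 → e ≡ 0
        double≤1 zero    _       = refl
        double≤1 (suc e) (s≤s h) = contradiction (m+n≤o⇒n≤o e h) λ ()

      one-neighbour : AtMostOne (adj G v ∩ (R ∩ fibre (colour I) y))
      one-neighbour = count≤1⇒≡ (≤-trans (count-mono outside-top)
                                         (m+n≤o⇒m≤o (count (outside ∩ fibre (colour I) y)) few))
        where
        outside-top : adj G v ∩ (R ∩ fibre (colour I) y) ⊆ outside ∩ fibre (colour I) y
        outside-top u h = let vu , h′ = ∈∩⁻ h ; u∈R , u∈y = ∈∩⁻ h′ in
          ∈∩⁺ (∈∩⁺ vu (∈∖⁺ u∈R (¬-not λ u∈b → fresh u u∈R (∈fibre⇒≡ u∈b) (∈fibre⇒≡ u∈y)))) u∈y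

  Admissible : Subset (n G) → ℕ → List V → Set
  Admissible Old j []       = ⊤
  Admissible Old j (s ∷ ss) = count (adj G s ∩ Old) + 2 * j < 2 * k × Admissible Old (suc j) ss

  add-vertices : OpenBlock Old R b j → {ss : List V} → Admissible Old j ss →
                 All (_∉ₛ R) ss → Unique ss → Colouring (R ∪ ⟦ ss ⟧) (suc b)
  add-vertices S {[]} _ _ _ = colouring-cong (⊆-antisym
    (λ v v∈R → ∈∪⁺ˡ v∈R)
    (λ v h → [ id , (λ ()) ]′ (∈∪⁻ h))) (colouring S)
  add-vertices {R = R} S {s ∷ ss} (room , admissible) (s∉R ∷ ss∉R) (s∉ss ∷ ss!) =
    colouring-cong (∪-assoc R ⁅ s ⁆ ⟦ ss ⟧)
      (add-vertices (add-vertex S s∉R room) admissible (All.zipWith ∉R∪s (ss∉R , s∉ss)) ss!)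
    where
    ∉R∪s : ∀ {w} → w ∉ₛ R × s ≢ w → w ∉ₛ R ∪ ⁅ s ⁆
    ∉R∪s (w∉R , s≢w) = ¬-not λ h → [ not-¬ w∉R , (λ w∈s → s≢w (sym (∈⁅⁆⇒≡ w∈s))) ]′ (∈∪⁻ h)

  admissible-++ : ∀ {xs ys} → Admissible Old j xs → Admissible Old (j + length xs) ys → Admissible Old j (xs ++ ys)
  admissible-++ {Old = Old} {j = j} {[]} {ys} _ adm = subst (λ i → Admissible Old i ys) (+-identityʳ j) adm
  admissible-++ {Old = Old} {j = j} {x ∷ xs} {ys} (room , adm) adm′ =
    room , admissible-++ adm (subst (λ i → Admissible Old i ys) (+-suc j (length xs)) adm′)

  admissible-uniform : ∀ d {ss} → All (λ s → count (adj G s ∩ Old) ≤ d) ss →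
                       d + 2 * (j + length ss) ≤ suc (2 * k) → Admissible Old j ss
  admissible-uniform d {[]} [] _ = tt
  admissible-uniform {Old = Old} {j = j} d {s ∷ ss} (s≤d ∷ ss≤d) bound =
    ≤-pred (≤-trans (s≤s (s≤s (+-monoˡ-≤ (2 * j) s≤d))) (≤-trans (m≤m+n _ _) (≤-trans (≤-reflexive (regroup d j (length ss))) bound))) ,
    admissible-uniform d ss≤d (subst (λ i → d + 2 * i ≤ suc (2 * k)) (+-suc j (length ss)) bound)
    where
    regroup : ∀ d j l → suc (suc (d + 2 * j)) + 2 * l ≡ d + 2 * (j + suc l)
    regroup = solve-∀

  record Block (T : Subset (n G)) (s : ℕ) : Set where
    field
      members    : List V
      size       : length members ≡ s
      distinct   : Unique members
      members⊆T  : ⟦ members ⟧ ⊆ T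
      admissible : Admissible (T ∖ ⟦ members ⟧) 0 members

  first-in-block : ∀ v → count (adj G v ∩ Old) + 2 * 0 < 2 * k
  first-in-block v = ≤-trans (s≤s (≤-trans (≤-reflexive (+-identityʳ _)) (count-mono λ u → proj₁ ∘ ∈∩⁻))) (degree< v)

  singleton-block : (T : Subset (n G)) → 0 < count T → Block T 1
  singleton-block T T≢∅ = let v , v∈T = count>0⇒∈ T≢∅ in record
    { members = v ∷ [] ; size = refl ; distinct = [] ∷ []
    ; members⊆T = λ u h → [ (λ u∈v → subst (_∈ₛ T) (sym (∈⁅⁆⇒≡ u∈v)) v∈T) , (λ ()) ]′ (∈∪⁻ h)
    ; admissible = first-in-block v , tt
    }

  large-block : (T : Subset (n G)) (r : ℕ) → 2 + r ≤ k → 2 + r ≤ count T → Block T (2 + r)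
  large-block T r s≤k s≤T with low-degree-vertex degenerate T (≤-trans (s≤s z≤n) s≤T)
  ... | x , x∈T , x-deg
    with count≤2⇒∃count∖⁅⁆≤1 x-deg (neighbours⊆ {G = G} x)
           (≤-pred (subst (2 ≤_) (count-remove x∈T) (≤-trans (s≤s (s≤s z≤n)) s≤T)))
  ... | u , u∈T∖x , x-deg′
    with peel degenerate r (T ∖ ⁅ x ⁆ ∖ ⁅ u ⁆)
           (≤-pred (≤-pred (subst (2 + r ≤_) (trans (count-remove x∈T) (cong suc (count-remove u∈T∖x))) s≤T)))
  ... | ms , length≡ , ms! , ms⊆ , sparse = record
    { members = u ∷ ms ++ x ∷ []
    ; size = cong suc (trans (length-++ ms) (trans (+-comm (length ms) 1) (cong suc length≡)))
    ; distinct = sandwich-unique {ms = ms} u∈T x∈T ms⊆ u≢x ms!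
    ; members⊆T = sandwich-⊆ {ms = ms} u∈T x∈T ms⊆
    ; admissible = first-in-block u ,
        admissible-++ (admissible-uniform {j = 1} 2 (All.map (≤-trans (count-mono (∩-monoʳ rest⊆))) sparse)
                                          (≤-trans (≤-reflexive (regroup₁ (length ms))) (≤-trans 2s≤2k (n≤1+n _))))
                      (admissible-uniform {j = 1 + length ms} 1 (x-sparse ∷ [])
                                          (≤-trans (≤-reflexive (regroup₂ (length ms))) (s≤s 2s≤2k)))
    }
    where
    u∈T : u ∈ₛ T
    u∈T = proj₁ (∈∖⁻ u∈T∖x)
    u≢x : u ≢ x
    u≢x u≡x = not-¬ (proj₂ (∈∖⁻ u∈T∖x)) (≡⇒∈⁅⁆ u≡x)

    rest⊆ : T ∖ ⟦ u ∷ ms ++ x ∷ [] ⟧ ⊆ T ∖ ⁅ x ⁆ ∖ ⁅ u ⁆ ∖ ⟦ ms ⟧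
    rest⊆ = sandwich-rest {ms = ms} u∈T x∈T ms⊆

    x-sparse : count (adj G x ∩ (T ∖ ⟦ u ∷ ms ++ x ∷ [] ⟧)) ≤ 1
    x-sparse = ≤-trans (count-mono λ v h →
      let xv , v∈rest = ∈∩⁻ h ; v∈T∖x∖u , _ = ∈∖⁻ (rest⊆ v v∈rest) ; v∈T∖x , v∉u = ∈∖⁻ v∈T∖x∖u in
      ∈∖⁺ (∈∩⁺ xv (proj₁ (∈∖⁻ v∈T∖x))) v∉u) x-deg′

    2s≤2k : 2 * (2 + length ms) ≤ 2 * k
    2s≤2k = *-monoʳ-≤ 2 (subst (λ l → 2 + l ≤ k) (sym length≡) s≤k)
    regroup₁ : ∀ l → 2 + 2 * (1 + l) ≡ 2 * (2 + l)
    regroup₁ = solve-∀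
    regroup₂ : ∀ l → 1 + 2 * ((1 + l) + 1) ≡ suc (2 * (2 + l))
    regroup₂ = solve-∀

  block-of-size : (T : Subset (n G)) (s : ℕ) → 0 < s → s ≤ k → s ≤ count T → Block T s
  block-of-size T 1             _ _   s≤T = singleton-block T s≤T
  block-of-size T (suc (suc r)) _ s≤k s≤T = large-block T r s≤k s≤T

  colour-block : (T : Subset (n G)) {s : ℕ} (blk : Block T s) →
                 Colouring (T ∖ ⟦ Block.members blk ⟧) B → Colouring T (suc B)
  colour-block T blk I = colouring-cong (∖∪-cover members⊆T)
    (add-vertices (open-block I) admissible (All.tabulate λ v∈ms → ∉∖ (∈⇒∈⟦⟧ v∈ms)) distinct)
    where open Block blk

  colour-all : ∀ t (T : Subset (n G)) → count T ≡ t → ∃[ B ] B ≤ ceilDiv t k × Colouring T B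
  colour-all = <-rec _ colour-step
    where
    colour-step : ∀ t → (∀ {t′} → t′ < t → ∀ T → count T ≡ t′ → ∃[ B ] B ≤ ceilDiv t′ k × Colouring T B) →
           ∀ T → count T ≡ t → ∃[ B ] B ≤ ceilDiv t k × Colouring T B
    colour-step zero    _   T T≡0 = 0 , z≤n , colouring-∅ λ v → ¬-not λ v∈T → <-irrefl (sym T≡0) (∈⇒count>0 v∈T)
    colour-step (suc c) rec T T≡t = finish (rec rest<t rest refl)
      where
      s : ℕ
      s = suc c ⊓ k
      0<s : 0 < s
      0<s = ⊓-glb (s≤s z≤n) (>-nonZero⁻¹ k)
      blk : Block T s
      blk = block-of-size T s 0<s (m⊓n≤n (suc c) k) (subst (s ≤_) (sym T≡t) (m⊓n≤m (suc c) k))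
      rest : Subset (n G)
      rest = T ∖ ⟦ Block.members blk ⟧
      split : count rest + s ≡ suc c
      split = trans (cong (count rest +_) (sym (Block.size blk)))
                    (trans (count-∖⟦⟧ (Block.distinct blk) (Block.members⊆T blk)) T≡t)
      rest<t : count rest < suc c
      rest<t = subst (count rest <_) split (m<m+n (count rest) 0<s)
      finish : ∃[ B ] B ≤ ceilDiv (count rest) k × Colouring rest B → ∃[ B ] B ≤ ceilDiv (suc c) k × Colouring T B
      finish (B , B≤ , I) = suc B , bound , colour-block T blk I
        where
        bound : suc B ≤ ceilDiv (suc c) k
        bound = ≤-trans (s≤s B≤) (subst (λ t → suc (ceilDiv (count rest) k) ≤ ceilDiv t k) split
                                        (ceilDiv-step (count rest) s k 0<s (cong (_⊓ k) split)))

  colouring⇒arboreal : Colouring (λ _ → true) B → B ≤ ceilDiv (n G) k →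
    Σ (V → ℕ) λ c → (∀ v → c v ∈ L v) × (∀ a → InducesForest G (colourClass G c a)) ×
                    (∀ a → countF (colourClass G c a) ≤ ceilDiv (n G) k)
  colouring⇒arboreal {B = B} I B≤ = colour I , (λ v → colour∈L I v refl) , forest′ , class-size
    where
    class≐ : ∀ a → colourClass G (colour I) a ≐ fibre (colour I) a
    class≐ = colourClass≐fibre G (colour I)

    forest′ : ∀ a → InducesForest G (colourClass G (colour I) a)
    forest′ a = forest-⊆ (λ v h → ∈∩⁺ refl (trans (sym (class≐ a v)) h)) (forest I a)

    class-size : ∀ a → countF (colourClass G (colour I) a) ≤ ceilDiv (n G) k
    class-size a = begin
      countF (colourClass G (colour I) a) ≡⟨ countF≡count _ ⟩
      count (colourClass G (colour I) a)  ≡⟨ count-cong (class≐ a) ⟩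
      count (fibre (colour I) a)          ≤⟨ count≤-injection (block I) B one-per-block (λ v _ → block< I v refl) ⟩
      B                                   ≤⟨ B≤ ⟩
      ceilDiv (n G) k                     ∎
      where
      open ≤-Reasoning
      one-per-block : ∀ u v → u ∈ₛ fibre (colour I) a → v ∈ₛ fibre (colour I) a → block I u ≡ block I v → u ≡ v
      one-per-block u v u∈a v∈a same-block =
        distinct-in-block I u v refl refl same-block (trans (∈fibre⇒≡ u∈a) (sym (∈fibre⇒≡ v∈a)))

≤-maxDegree : (G : Graph) (v : Fin (n G)) → degree G v ≤ maxDegree G
≤-maxDegree G v = go (allFin (n G)) (∈-allFin v)
  where
  go : ∀ vs → v ∈ vs → degree G v ≤ foldr (λ u acc → degree G u ⊔ acc) 0 vs
  go (u ∷ vs) (here refl) = m≤m⊔n _ _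
  go (u ∷ vs) (there v∈vs) = ≤-trans (go vs v∈vs) (m≤n⊔m _ _)

degree<2k : {G : Graph} {k : ℕ} → ⌈ suc (maxDegree G) /2⌉ ≤ k → ∀ v → count (adj G v) < 2 * k
degree<2k {G} {k} Δ+1≤2k v = begin-strict
  count (adj G v)                          ≡⟨ countF≡count (adj G v) ⟨
  degree G v                               <⟨ s≤s (≤-maxDegree G v) ⟩
  suc (maxDegree G)                        ≡⟨ ⌊n/2⌋+⌈n/2⌉≡n (suc (maxDegree G)) ⟨
  ⌊ suc Δ /2⌋ + ⌈ suc Δ /2⌉                ≤⟨ +-mono-≤ (≤-trans (⌊n/2⌋≤⌈n/2⌉ (suc Δ)) Δ+1≤2k) Δ+1≤2k ⟩
  k + k                                    ≡⟨ cong (k +_) (+-identityʳ k) ⟨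
  2 * k                                    ∎
  where
  open ≤-Reasoning
  Δ : ℕ
  Δ = maxDegree G

theorem2 : (G : Graph) → Degenerate 2 G →
    (k : ℕ) → ⌈ suc (maxDegree G) /2⌉ ≤ k →
    EquitableListPointArborable k G
theorem2 G degenerate zero () _
theorem2 G degenerate k@(suc _) ⌈Δ+1/2⌉≤k (L , L-ok) =
  let B , B≤ , I = colour-all (n G) (λ _ → true) (count-full {n G}) in colouring⇒arboreal I B≤
  where open Construction G degenerate k (degree<2k {G} ⌈Δ+1/2⌉≤k) L (proj₁ ∘ L-ok) (proj₂ ∘ L-ok)
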